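{- For $n\geq 1$, the number of permutations $\pi\in\mathcal{S}_n$ such that both $\pi$ and $\theta(\pi)$ avoid $312$ equals $2^{n-1}$.
   Context: $\mathcal{S}_n$ is the symmetric group on $[n]$, permutations in one-line notation $\pi_1\cdots\pi_n$. A permutation avoids a pattern $\tau$ if it has no subsequence order-isomorphic to $\tau$. The standard cycle notation of $\pi$ writes each cycle (fixed points included) with its largest element first and orders cycles by increasing largest element. The fundamental bijection $\theta:\mathcal{S}_n\to\mathcal{S}_n$ maps $\pi$ to the permutation whose one-line notation is obtained by erasing the parentheses of the standard cycle notation of $\pi$. -}

module Defs where

open import Data.Bool using (Bool; true; false; _∧_; _∨_; not; if_then_else_)
open import Data.Nat using (ℕ; zero; suc; _<ᵇ_; _≤ᵇ_)
open import Data.Fin using (Fin; toℕ; _≟_)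
open import Data.List using (List; []; _∷_; [_]; map; concatMap; allFin; iterate; takeWhile; filter; filterᵇ; length)
open import Data.Bool.ListAction using (all; any)
open import Data.Vec using (Vec; lookup; toList) renaming ([] to []ᵥ; _∷_ to _∷ᵥ_)
open import Relation.Nullary using (¬?)
import Data.Fin.Properties as FinP
open import Data.List.Relation.Unary.Unique.Propositional using (Unique)
import Data.List.Relation.Unary.Unique.DecPropositional as UDP

-- Permutations of [n] are represented in one-line notation as vectors
-- π = π₁ ⋯ πₙ over Fin n (the value i : Fin n stands for i+1 ∈ [n]),
-- with pairwise distinct entries.

words : ∀ {n} k → List (Vec (Fin n) k)
words zero = [ []ᵥ ]
words {n} (suc k) = concatMap (λ x → map (x ∷ᵥ_) (words k)) (allFin n)

Sym : (n : ℕ) → List (Vec (Fin n) n)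
Sym n = filter (λ v → UDP.unique? _≟_ (toList v)) (words n)

orbit : ∀ {n} → Vec (Fin n) n → Fin n → List (Fin n)
orbit {n} π m = m ∷ takeWhile (λ x → ¬? (x ≟ m)) (iterate (lookup π) (lookup π m) n)

isCycleMax : ∀ {n} → Vec (Fin n) n → Fin n → Bool
isCycleMax π m = all (λ x → toℕ x ≤ᵇ toℕ m) (orbit π m)

-- the fundamental bijection θ: erase parentheses in the standard cycle
-- notation (each cycle written with its largest element first, cycles in
-- increasing order of their largest elements).
θ : ∀ {n} → Vec (Fin n) n → List (Fin n)
θ {n} π = concatMap (λ m → if isCycleMax π m then orbit π m else []) (allFin n)

below12 : ℕ → List ℕ → Bool
below12 a [] = false
below12 a (b ∷ l) = any (λ c → (b <ᵇ c) ∧ (c <ᵇ a)) l ∨ below12 a l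

has312 : List ℕ → Bool
has312 [] = false
has312 (a ∷ l) = below12 a l ∨ has312 l

avoids312 : ∀ {n} → List (Fin n) → Bool
avoids312 w = not (has312 (map toℕ w))

count312θ : ℕ → ℕ
count312θ n = length (filterᵇ (λ π → avoids312 (toList π) ∧ avoids312 (θ π)) (Sym n))

{-# OPTIONS --safe #-}
module Submission where

-- Both π and θ(π) avoid 312 exactly when π is layered: a concatenation of runs of consecutive
-- values, each run written decreasingly and the runs increasing (e.g. 1 432 65). Layered
-- permutations of [n] correspond to compositions of n, hence there are 2^(n-1) of them.
--
-- A layered permutation is a 312-avoiding involution, and θ lists its 2-cycles as blocks
-- max min and its fixed points singly, in increasing order of max; so an occurrence c a b of
-- 312 in θ(π) yields the occurrence π(b) a b at positions b < π(a) < π(b) in π. Conversely let π and θ(π) avoid 312.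
-- If π is not an involution, let M be the largest point on a cycle of length at least 3. In
-- θ(π) this cycle is the block M x₁ x₂ … x_r with all xᵢ < M, so it decreases after M; then
-- r ≥ 2 and positions x_r < x_{r-1} < M of π carry the 312 pattern M x_r x₁. Finally, in a
-- 312-avoiding involution the smallest point p not covered by earlier layers starts a layer:
-- π reverses the interval [p, π(p)].

open import Data.Bool using (Bool; true; false; T; T?; _∧_; if_then_else_)
open import Data.Bool.ListAction using (all; and)
open import Data.Bool.Properties using (T-∧; T-∨; T-≡; if-float)
open import Data.Empty using (⊥; ⊥-elim)
open import Data.Fin using (Fin; toℕ)
open import Data.Fin.Properties using (toℕ-injective; toℕ<n; toℕ-fromℕ<) renaming (_≟_ to _≟ᶠ_)
open import Data.List
  using (List; []; _∷_; _++_; map; concatMap; length; filter; filterᵇ; tabulate; allFin; iterate; takeWhile)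
open import Data.List.Membership.Propositional using (_∈_; find)
open import Data.List.Membership.Propositional.Properties using (∈-++⁻; ∈-map⁻; ∈-concat⁻′)
open import Data.List.Properties
  using ( filter-++; length-++; map-++; map-∘; map-cong; map-tabulate; tabulate-cong
        ; map-concatMap; concatMap-map; concatMap-cong)
open import Data.List.Relation.Binary.Sublist.Propositional
  using (_⊆_; []; _∷_; _∷ʳ_; minimum; from∈; to∈; ⊆-refl; ⊆-trans)
open import Data.List.Relation.Binary.Sublist.Propositional.Properties using (map⁺; ∷ˡ⁻; ++⁺ˡ; ++⁺ʳ)
open import Data.List.Relation.Unary.All as All using (All; []; _∷_)
open import Data.List.Relation.Unary.All.Properties using (all⁺; all⁻; tabulate⁻)
open import Data.List.Relation.Unary.AllPairs using (AllPairs; []; _∷_)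
import Data.List.Relation.Unary.Any as Any
open import Data.List.Relation.Unary.Any.Properties using (any⁺; any⁻)
open import Data.List.Relation.Unary.Unique.Propositional using (Unique)
open import Data.List.Relation.Unary.Unique.Propositional.Properties using (tabulate⁺)
open import Data.Nat
open import Data.Nat.DivMod using (_mod_; m<n⇒m%n≡m)
open import Data.Nat.Induction using (<-wellFounded)
open import Data.Nat.ListAction using (sum)
open import Data.Nat.ListAction.Properties using (sum-++)
open import Data.Nat.Properties
open import Data.Nat.Tactic.RingSolver using (solve-∀)
open import Data.Product using (∃; ∃₂; _×_; _,_; proj₁; proj₂)
open import Data.Sum using (_⊎_; inj₁; inj₂)
open import Data.Vec using (Vec; toList; lookup) renaming ([] to []ᵥ; _∷_ to _∷ᵥ_)
open import Function using (_∘_; _⇔_; mk⇔; Equivalence; case_of_)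
open import Induction.WellFounded using (Acc; acc)
open import Relation.Binary.PropositionalEquality
open import Relation.Nullary using (¬_; ¬?; yes; no)
open import Relation.Unary using (Decidable)

open import Defs

open Equivalence using (to; from)

data Has312 (w : List ℕ) : Set where
  occurrence : ∀ {c a b} → c ∷ a ∷ b ∷ [] ⊆ w → a < b → b < c → Has312 w

below12-sound : ∀ a l → T (below12 a l) → ∃₂ λ b c → b ∷ c ∷ [] ⊆ l × b < c × c < a
below12-sound a (b ∷ l) t with to T-∨ t
... | inj₁ t′ = let c , c∈l , b<ᵇc<ᵇa = find (any⁻ _ l t′) ; b<ᵇc , c<ᵇa = to T-∧ b<ᵇc<ᵇa
                in b , c , refl ∷ from∈ c∈l , <ᵇ⇒< b c b<ᵇc , <ᵇ⇒< c a c<ᵇa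
... | inj₂ t′ = let b′ , c , τ , b<c , c<a = below12-sound a l t′ in b′ , c , b ∷ʳ τ , b<c , c<a

below12-complete : ∀ {a b c l} → b ∷ c ∷ [] ⊆ l → b < c → c < a → T (below12 a l)
below12-complete (_ ∷ʳ τ) b<c c<a = from T-∨ (inj₂ (below12-complete τ b<c c<a))
below12-complete (refl ∷ τ) b<c c<a =
  from T-∨ (inj₁ (any⁺ _ (Any.map (λ { refl → from T-∧ (<⇒<ᵇ b<c , <⇒<ᵇ c<a) }) (to∈ τ))))

has312⇔Has312 : ∀ w → T (has312 w) ⇔ Has312 w
has312⇔Has312 w = mk⇔ (sound w) complete
  where
  sound : ∀ w → T (has312 w) → Has312 w
  sound (c ∷ l) t with to T-∨ t
  ... | inj₁ t′ = let a , b , τ , a<b , b<c = below12-sound c l t′ in occurrence (refl ∷ τ) a<b b<c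
  ... | inj₂ t′ with sound l t′
  ...   | occurrence τ a<b b<c = occurrence (c ∷ʳ τ) a<b b<c
  complete : ∀ {w} → Has312 w → T (has312 w)
  complete (occurrence (_ ∷ʳ τ) a<b b<c) = from T-∨ (inj₂ (complete (occurrence τ a<b b<c)))
  complete (occurrence (refl ∷ τ) a<b b<c) = from T-∨ (inj₁ (below12-complete τ a<b b<c))

avoids312⇔¬Has312 : ∀ {m} (w : List (Fin m)) → T (avoids312 w) ⇔ (¬ Has312 (map toℕ w))
avoids312⇔¬Has312 w with has312 (map toℕ w) in eq
... | true = mk⇔ (λ ()) (λ ¬has → ¬has (to (has312⇔Has312 _) (from T-≡ eq)))
... | false = mk⇔ (λ _ has → subst T eq (from (has312⇔Has312 _) has)) (λ _ → _)

segment : ℕ → ℕ → List ℕ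
segment s zero = []
segment s (suc k) = s ∷ segment (suc s) k

InSegment : ℕ → ℕ → ℕ → Set
InSegment s k i = s ≤ i × i < s + k

InSegment-empty : ∀ {s i} → ¬ InSegment s 0 i
InSegment-empty {s} (s≤i , i<s) = <⇒≱ i<s (subst (_≤ _) (sym (+-identityʳ s)) s≤i)

start∈segment : ∀ s k → InSegment s (suc k) s
start∈segment s k = ≤-refl , m<m+n s z<s

InSegment-suc⁻ : ∀ {s k i} → InSegment (suc s) k i → InSegment s (suc k) i
InSegment-suc⁻ {s} {k} {i} (s<i , i<) = <⇒≤ s<i , subst (i <_) (sym (+-suc s k)) i<

InSegment-suc⁺ : ∀ {s k i} → s < i → InSegment s (suc k) i → InSegment (suc s) k i
InSegment-suc⁺ {s} {k} {i} s<i (_ , i<) = s<i , subst (i <_) (+-suc s k) i<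

∈-segment⁻ : ∀ {s k i} → i ∈ segment s k → InSegment s k i
∈-segment⁻ {s} {suc k} (Any.here refl) = start∈segment s k
∈-segment⁻ {s} {suc k} (Any.there i∈) = InSegment-suc⁻ (∈-segment⁻ i∈)

∈-segment⁺ : ∀ {s k i} → InSegment s k i → i ∈ segment s k
∈-segment⁺ {k = zero} i∈ = ⊥-elim (InSegment-empty i∈)
∈-segment⁺ {s} {suc k} i∈@(s≤i , _) with m≤n⇒m<n∨m≡n s≤i
... | inj₂ refl = Any.here refl
... | inj₁ s<i = Any.there (∈-segment⁺ (InSegment-suc⁺ s<i i∈))

⊆-segment⁻ : ∀ {s k is} → is ⊆ segment s k → AllPairs _<_ is × All (InSegment s k) is
⊆-segment⁻ {k = zero} [] = [] , []
⊆-segment⁻ {s} {suc k} (_ ∷ʳ τ) =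
  let increasing , bounds = ⊆-segment⁻ τ in increasing , All.map InSegment-suc⁻ bounds
⊆-segment⁻ {s} {suc k} (refl ∷ τ) =
  let increasing , bounds = ⊆-segment⁻ τ
  in All.map proj₁ bounds ∷ increasing , start∈segment s k ∷ All.map InSegment-suc⁻ bounds

⊆-segment⁺ : ∀ {s k is} → AllPairs _<_ is → All (InSegment s k) is → is ⊆ segment s k
⊆-segment⁺ {k = zero} [] [] = []
⊆-segment⁺ {k = zero} (_ ∷ _) (i∈ ∷ _) = ⊥-elim (InSegment-empty i∈)
⊆-segment⁺ {k = suc k} [] [] = minimum _
⊆-segment⁺ {s} {suc k} (i<is ∷ increasing) (i∈@(s≤i , _) ∷ bounds) with m≤n⇒m<n∨m≡n s≤i
... | inj₂ refl =
  refl ∷ ⊆-segment⁺ increasing (All.zipWith (λ (i<j , j∈) → InSegment-suc⁺ i<j j∈) (i<is , bounds))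
... | inj₁ s<i =
  s ∷ʳ ⊆-segment⁺ (i<is ∷ increasing)
                  (InSegment-suc⁺ s<i i∈ ∷
                   All.zipWith (λ (i<j , j∈) → InSegment-suc⁺ (<-trans s<i i<j) j∈) (i<is , bounds))

⊆-map⁻ : ∀ {A B : Set} (f : A → B) {xs} ys → xs ⊆ map f ys → ∃ λ zs → zs ⊆ ys × map f zs ≡ xs
⊆-map⁻ f [] [] = [] , [] , refl
⊆-map⁻ f (y ∷ ys) (_ ∷ʳ τ) = let zs , σ , eq = ⊆-map⁻ f ys τ in zs , y ∷ʳ σ , eq
⊆-map⁻ f (y ∷ ys) (refl ∷ τ) = let zs , σ , eq = ⊆-map⁻ f ys τ in y ∷ zs , refl ∷ σ , cong (f y ∷_) eq

Avoids312 : (ℕ → ℕ) → ℕ → ℕ → Set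
Avoids312 h p r = ∀ {i j l} → p ≤ i → i < j → j < l → l < r → h j < h l → h l < h i → ⊥

¬Has312⇔Avoids312 : ∀ h p k → (¬ Has312 (map h (segment p k))) ⇔ Avoids312 h p (p + k)
¬Has312⇔Avoids312 h p k = mk⇔ avoids unoccupied
  where
  avoids : ¬ Has312 (map h (segment p k)) → Avoids312 h p (p + k)
  avoids ¬has p≤i i<j j<l l< hj<hl hl<hi = ¬has (occurrence (map⁺ h (⊆-segment⁺ increasing bounds)) hj<hl hl<hi)
    where
    increasing = (i<j ∷ <-trans i<j j<l ∷ []) ∷ (j<l ∷ []) ∷ [] ∷ []
    bounds = (p≤i , <-trans i<j (<-trans j<l l<)) ∷
             (≤-trans p≤i (<⇒≤ i<j) , <-trans j<l l<) ∷
             (≤-trans p≤i (<⇒≤ (<-trans i<j j<l)) , l<) ∷ []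
  unoccupied : Avoids312 h p (p + k) → ¬ Has312 (map h (segment p k))
  unoccupied avoid (occurrence τ a<b b<c) with ⊆-map⁻ h (segment p k) τ
  ... | i ∷ j ∷ l ∷ [] , σ , refl with ⊆-segment⁻ σ
  ...   | (i<j ∷ _) ∷ (j<l ∷ []) ∷ [] ∷ [] , (p≤i , _) ∷ _ ∷ (_ , l<) ∷ [] = avoid p≤i i<j j<l l< a<b b<c

MapsBelow : (ℕ → ℕ) → ℕ → Set
MapsBelow h n = ∀ {i} → i < n → h i < n

InjectiveBelow : (ℕ → ℕ) → ℕ → Set
InjectiveBelow h n = ∀ {i j} → i < n → j < n → h i ≡ h j → i ≡ j

Involution : (ℕ → ℕ) → ℕ → ℕ → Set
Involution h p r = ∀ {i} → p ≤ i → i < r → (p ≤ h i × h i < r) × h (h i) ≡ i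

involution-injective : ∀ {h p r a b} → Involution h p r →
  p ≤ a → a < r → p ≤ b → b < r → h a ≡ h b → a ≡ b
involution-injective {h} involution p≤a a<r p≤b b<r ha≡hb =
  trans (sym (proj₂ (involution p≤a a<r))) (trans (cong h ha≡hb) (proj₂ (involution p≤b b<r)))

≡ᵇ-true⇒≡ : ∀ {a m} → (a ≡ᵇ m) ≡ true → a ≡ m
≡ᵇ-true⇒≡ {a} {m} eq = ≡ᵇ⇒≡ a m (from T-≡ eq)

≡ᵇ-false⇒≢ : ∀ {a m} → (a ≡ᵇ m) ≡ false → a ≢ m
≡ᵇ-false⇒≢ {a} {m} eq a≡m = subst T eq (≡⇒≡ᵇ a m a≡m)

walk : (ℕ → ℕ) → ℕ → ℕ → ℕ → List ℕ
walk h m a zero = []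
walk h m a (suc k) = if a ≡ᵇ m then [] else a ∷ walk h m (h a) k

cycleFrom : (ℕ → ℕ) → ℕ → ℕ → List ℕ
cycleFrom h n m = m ∷ walk h m (h m) n

cycleBlock : (ℕ → ℕ) → ℕ → ℕ → List ℕ
cycleBlock h n m = if all (_≤ᵇ m) (cycleFrom h n m) then cycleFrom h n m else []

θℕ : (ℕ → ℕ) → ℕ → List ℕ
θℕ h n = concatMap (cycleBlock h n) (segment 0 n)

∈-if⁻ : ∀ {A : Set} {y : A} b xs → y ∈ (if b then xs else []) → T b × y ∈ xs
∈-if⁻ true xs y∈ = _ , y∈

pair⊆-++⁻ : ∀ {A : Set} {u v : A} xs {ys : List A} →
  u ∷ v ∷ [] ⊆ xs ++ ys → (u ∈ xs × v ∈ xs ++ ys) ⊎ u ∷ v ∷ [] ⊆ ys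
pair⊆-++⁻ [] τ = inj₂ τ
pair⊆-++⁻ (x ∷ xs) (refl ∷ τ) = inj₁ (Any.here refl , Any.there (to∈ τ))
pair⊆-++⁻ (x ∷ xs) (_ ∷ʳ τ) with pair⊆-++⁻ xs τ
... | inj₁ (u∈ , v∈) = inj₁ (Any.there u∈ , Any.there v∈)
... | inj₂ τ′ = inj₂ τ′

module _ (f : ℕ → List ℕ) where

  ⊆-concatMap-segment : ∀ {s m i} → InSegment s m i → f i ⊆ concatMap f (segment s m)
  ⊆-concatMap-segment {m = zero} i∈ = ⊥-elim (InSegment-empty i∈)
  ⊆-concatMap-segment {s} {suc m} i∈@(s≤i , _) with m≤n⇒m<n∨m≡n s≤i
  ... | inj₂ refl = ++⁺ʳ _ ⊆-refl
  ... | inj₁ s<i = ++⁺ˡ (f s) (⊆-concatMap-segment (InSegment-suc⁺ s<i i∈))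

  ∈-concatMap-segment⁻ : ∀ {s m y} → y ∈ concatMap f (segment s m) → ∃ λ i → InSegment s m i × y ∈ f i
  ∈-concatMap-segment⁻ {s} {m} y∈ with ∈-concat⁻′ (map f (segment s m)) y∈
  ... | _ , y∈fi , fi∈ with ∈-map⁻ f fi∈
  ...   | i , i∈ , refl = i , ∈-segment⁻ i∈ , y∈fi

  pair⊆-concatMap-segment⁻ : ∀ {s m u v} → u ∷ v ∷ [] ⊆ concatMap f (segment s m) →
    ∃₂ λ i j → i ≤ j × InSegment s m i × InSegment s m j × u ∈ f i × v ∈ f j
  pair⊆-concatMap-segment⁻ {s} {suc m} τ with pair⊆-++⁻ (f s) {concatMap f (segment (suc s) m)} τ
  ... | inj₂ τ′ = let i , j , i≤j , i∈ , j∈ , u∈ , v∈ = pair⊆-concatMap-segment⁻ τ′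
                  in i , j , i≤j , InSegment-suc⁻ i∈ , InSegment-suc⁻ j∈ , u∈ , v∈
  ... | inj₁ (u∈ , v∈) with ∈-++⁻ (f s) v∈
  ...   | inj₁ v∈fs = s , s , ≤-refl , start∈segment s m , start∈segment s m , u∈ , v∈fs
  ...   | inj₂ v∈rest = let j , j∈ , v∈fj = ∈-concatMap-segment⁻ v∈rest
                        in s , j , <⇒≤ (proj₁ j∈) , start∈segment s m , InSegment-suc⁻ j∈ , u∈ , v∈fj

-- Involutions avoiding 312

walk-to-start : ∀ h m k → walk h m m k ≡ []
walk-to-start h m zero = refl
walk-to-start h m (suc k) with m ≡ᵇ m | ≡⇒≡ᵇ m m refl
... | true | _ = refl

h∈cycleFrom : ∀ h {n} m → 0 < n → h m ∈ cycleFrom h n m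
h∈cycleFrom h {suc k} m _ with h m ≡ᵇ m in eq
... | true = Any.here (≡ᵇ-true⇒≡ eq)
... | false = Any.there (Any.here refl)

∈-cycleFrom-involutive : ∀ {h k m y} → h (h m) ≡ m → y ∈ cycleFrom h k m → y ≡ m ⊎ y ≡ h m
∈-cycleFrom-involutive _ (Any.here y≡m) = inj₁ y≡m
∈-cycleFrom-involutive {h} {suc k} {m} {y} hhm (Any.there y∈) with h m ≡ᵇ m | y∈
... | false | Any.here y≡hm = inj₂ y≡hm
... | false | Any.there y∈′ with subst (y ∈_) (trans (cong (λ a → walk h m a k) hhm) (walk-to-start h m k)) y∈′
...   | ()

m<m⊔n⇒m⊔n≡n : ∀ {m n} → m < m ⊔ n → m ⊔ n ≡ n
m<m⊔n⇒m⊔n≡n {m} {n} m<m⊔n with ⊔-sel m n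
... | inj₁ m⊔n≡m = ⊥-elim (<-irrefl (sym m⊔n≡m) m<m⊔n)
... | inj₂ m⊔n≡n = m⊔n≡n

module _ {h n} (involution : Involution h 0 n) (avoid : Avoids312 h 0 n) where

  private
    cycleMax : ℕ → ℕ
    cycleMax y = y ⊔ h y

  ∈-cycleBlock : ∀ {i y} → i < n → y ∈ cycleBlock h n i → cycleMax y ≡ i × y < n
  ∈-cycleBlock {i} i<n y∈ = case ∈-cycleFrom-involutive {h} {n} hhi y∈cycle of λ where
      (inj₁ refl) → m≥n⇒m⊔n≡m hi≤i , i<n
      (inj₂ refl) → trans (cong (h i ⊔_) hhi) (m≤n⇒m⊔n≡n hi≤i) , hi<n
    where
    hi<n = proj₂ (proj₁ (involution z≤n i<n))
    hhi = proj₂ (involution z≤n i<n)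
    isMax = proj₁ (∈-if⁻ (all (_≤ᵇ i) (cycleFrom h n i)) _ y∈)
    y∈cycle = proj₂ (∈-if⁻ (all (_≤ᵇ i) (cycleFrom h n i)) _ y∈)
    hi≤i = ≤ᵇ⇒≤ (h i) i (All.lookup (all⁺ _ _ isMax) (h∈cycleFrom h i (≤-<-trans z≤n i<n)))

  cycleMax-monotone : ∀ {u v} → u ∷ v ∷ [] ⊆ θℕ h n → cycleMax u ≤ cycleMax v × u < n × v < n
  cycleMax-monotone τ with pair⊆-concatMap-segment⁻ (cycleBlock h n) {0} {n} τ
  ... | i , j , i≤j , (_ , i<n) , (_ , j<n) , u∈ , v∈ =
    let Mu≡i , u<n = ∈-cycleBlock i<n u∈ ; Mv≡j , v<n = ∈-cycleBlock j<n v∈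
    in subst₂ _≤_ (sym Mu≡i) (sym Mv≡j) i≤j , u<n , v<n

  θℕ-avoids312 : ¬ Has312 (θℕ h n)
  θℕ-avoids312 (occurrence {c} {a} {b} τ a<b b<c)
    with cycleMax-monotone (⊆-trans (refl ∷ refl ∷ b ∷ʳ []) τ) | cycleMax-monotone (∷ˡ⁻ τ)
  ... | Mc≤Ma , _ | Ma≤Mb , a<n , b<n with involution z≤n a<n | involution z≤n b<n
  ... | _ , hha | (_ , hb<n) , hhb =
    avoid z≤n b<ha ha<hb hb<n (subst₂ _<_ (sym hha) (sym hhb) a<b) (subst (_< h b) (sym hhb) (<-trans b<ha ha<hb))
    where
    c≤Ma : c ≤ cycleMax a
    c≤Ma = ≤-trans (m≤m⊔n c (h c)) Mc≤Ma
    Ma≡ha : cycleMax a ≡ h a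
    Ma≡ha = m<m⊔n⇒m⊔n≡n (<-≤-trans (<-trans a<b b<c) c≤Ma)
    Mb≡hb : cycleMax b ≡ h b
    Mb≡hb = m<m⊔n⇒m⊔n≡n (<-≤-trans b<c (≤-trans c≤Ma Ma≤Mb))
    b<ha : b < h a
    b<ha = <-≤-trans b<c (subst (c ≤_) Ma≡ha c≤Ma)
    ha<hb : h a < h b
    ha<hb = ≤∧≢⇒< (subst₂ _≤_ Ma≡ha Mb≡hb Ma≤Mb) (<⇒≢ a<b ∘ involution-injective involution z≤n a<n z≤n b<n)

-- Cycles of length at least three

largest-below : ∀ {P : ℕ → Set} → Decidable P → ∀ B {x} → x < B → P x →
  ∃ λ M → M < B × P M × (∀ {y} → y < B → P y → y ≤ M)
largest-below P? (suc B) x<1+B px with P? B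
... | yes pB = B , ≤-refl , pB , λ y<1+B _ → s≤s⁻¹ y<1+B
... | no ¬pB with m≤n⇒m<n∨m≡n (s≤s⁻¹ x<1+B)
...   | inj₂ refl = ⊥-elim (¬pB px)
...   | inj₁ x<B =
  let M , M<B , pM , maximal = largest-below P? B x<B px
  in M , m<n⇒m<1+n M<B , pM , λ y<1+B py → case m≤n⇒m<n∨m≡n (s≤s⁻¹ y<1+B) of λ where
       (inj₁ y<B) → maximal y<B py
       (inj₂ refl) → ⊥-elim (¬pB py)

start∈walk : ∀ {h m a k} → a ≢ m → 0 < k → a ∈ walk h m a k
start∈walk {m = m} {a} {suc k} a≢m _ with a ≡ᵇ m in eq
... | true = ⊥-elim (a≢m (≡ᵇ-true⇒≡ eq))
... | false = Any.here refl

ReturnsTo : (ℕ → ℕ) → ℕ → ℕ → Set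
ReturnsTo h m a = h a ≡ m ⊎ ∃₂ λ y z → h y ≡ z × h z ≡ m × z < y × y ≤ a

ReturnsTo-step : ∀ {h m a} → h a < a → ReturnsTo h m (h a) → ReturnsTo h m a
ReturnsTo-step {a = a} ha<a (inj₁ hha≡m) = inj₂ (a , _ , refl , hha≡m , ha<a , ≤-refl)
ReturnsTo-step ha<a (inj₂ (y , z , hy≡z , hz≡m , z<y , y≤ha)) =
  inj₂ (y , z , hy≡z , hz≡m , z<y , ≤-trans y≤ha (<⇒≤ ha<a))

-- Without fixed points and ascents the walk strictly descends from a, so with more than a + 1
-- steps of fuel it cannot run out before stopping at m.
walk-returns : ∀ {h m} k a → suc a < k → a ≢ m →
  (∀ {y} → y ∈ walk h m a k → h y ≢ y) →
  (∀ {u v} → u ∷ v ∷ [] ⊆ walk h m a k → v ≤ u) →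
  ReturnsTo h m a
walk-returns {h} {m} (suc k) a 1+a<1+k a≢m moving nonAscending with a ≡ᵇ m in eq
... | true = ⊥-elim (a≢m (≡ᵇ-true⇒≡ eq))
... | false with h a ≟ m
...   | yes ha≡m = inj₁ ha≡m
...   | no ha≢m =
  ReturnsTo-step ha<a (walk-returns k (h a) 2+ha≤k ha≢m (moving ∘ Any.there) (nonAscending ∘ (a ∷ʳ_)))
  where
  ha<a : h a < a
  ha<a = ≤∧≢⇒< (nonAscending (refl ∷ from∈ (start∈walk ha≢m (≤-<-trans z≤n (s≤s⁻¹ 1+a<1+k)))))
               (moving (Any.here refl))
  2+ha≤k : suc (h a) < k
  2+ha≤k = ≤-<-trans ha<a (s≤s⁻¹ 1+a<1+k)

module _ {h n} (maps : MapsBelow h n) (injective : InjectiveBelow h n)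
         (avoid : Avoids312 h 0 n) (avoidθ : ¬ Has312 (θℕ h n)) where

  private
    NonInvolutive : ℕ → Set
    NonInvolutive y = y < n × h (h y) ≢ y

    nonInvolutive-step : ∀ {y} → NonInvolutive y → NonInvolutive (h y)
    nonInvolutive-step (y<n , hhy≢y) =
      maps y<n , λ hhhy≡hy → hhy≢y (injective (maps (maps y<n)) y<n hhhy≡hy)

    nonInvolutive-moving : ∀ {y} → NonInvolutive y → h y ≢ y
    nonInvolutive-moving (_ , hhy≢y) hy≡y = hhy≢y (trans (cong h hy≡y) hy≡y)

    walk-nonInvolutive : ∀ {m} k {a} → NonInvolutive a → ∀ {y} → y ∈ walk h m a k → NonInvolutive y × y ≢ m
    walk-nonInvolutive {m} (suc k) {a} nonInv y∈ with a ≡ᵇ m in eq | y∈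
    ... | false | Any.here refl = nonInv , ≡ᵇ-false⇒≢ eq
    ... | false | Any.there y∈′ = walk-nonInvolutive k (nonInvolutive-step nonInv) y∈′

    largest-nonInvolutive-absurd : ∀ {M} → NonInvolutive M → (∀ {y} → NonInvolutive y → y ≤ M) → ⊥
    largest-nonInvolutive-absurd {M} nonInvM@(M<n , hhM≢M) maximal =
      returns-absurd (walk-returns n x₁ 1+x₁<n x₁≢M (nonInvolutive-moving ∘ proj₁ ∘ onCycle) nonAscending)
      where
      x₁ : ℕ
      x₁ = h M
      cycle : List ℕ
      cycle = walk h M x₁ n
      onCycle : ∀ {y} → y ∈ cycle → NonInvolutive y × y ≢ M
      onCycle = walk-nonInvolutive n (nonInvolutive-step nonInvM)
      below : ∀ {y} → y ∈ cycle → y < M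
      below y∈ = let nonInv , y≢M = onCycle y∈ in ≤∧≢⇒< (maximal nonInv) y≢M
      isBlock : cycleBlock h n M ≡ M ∷ cycle
      isBlock = cong (λ b → if b then M ∷ cycle else [])
        (to T-≡ (all⁻ (_≤ᵇ M) {xs = M ∷ cycle} (≤⇒≤ᵇ (≤-refl {M}) ∷ All.tabulate (≤⇒≤ᵇ ∘ <⇒≤ ∘ below))))
      block⊆θ : M ∷ cycle ⊆ θℕ h n
      block⊆θ = subst (_⊆ θℕ h n) isBlock (⊆-concatMap-segment (cycleBlock h n) (z≤n , M<n))
      nonAscending : ∀ {u v} → u ∷ v ∷ [] ⊆ cycle → v ≤ u
      nonAscending τ = ≮⇒≥ λ u<v → avoidθ (occurrence (⊆-trans (refl ∷ τ) block⊆θ) u<v (below (to∈ (∷ˡ⁻ τ))))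
      x₁≢M : x₁ ≢ M
      x₁≢M x₁≡M = hhM≢M (trans (cong h x₁≡M) x₁≡M)
      x₁<M : x₁ < M
      x₁<M = ≤∧≢⇒< (maximal (nonInvolutive-step nonInvM)) x₁≢M
      1+x₁<n : suc x₁ < n
      1+x₁<n = <-≤-trans (s≤s x₁<M) M<n
      returns-absurd : ReturnsTo h M x₁ → ⊥
      returns-absurd (inj₁ hx₁≡M) = hhM≢M hx₁≡M
      returns-absurd (inj₂ (y , z , hy≡z , hz≡M , z<y , y≤x₁)) =
        avoid z≤n z<y (≤-<-trans y≤x₁ x₁<M) M<n
              (subst (_< x₁) (sym hy≡z) (<-≤-trans z<y y≤x₁)) (subst (x₁ <_) (sym hz≡M) x₁<M)

  θ-avoiding⇒involutive : ∀ {i} → i < n → h (h i) ≡ i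
  θ-avoiding⇒involutive {i} i<n with h (h i) ≟ i
  ... | yes hhi≡i = hhi≡i
  ... | no hhi≢i =
    let M , M<n , hhM≢M , maximal = largest-below (λ y → ¬? (h (h y) ≟ y)) n i<n hhi≢i
    in ⊥-elim (largest-nonInvolutive-absurd (M<n , hhM≢M) (λ (y<n , hhy≢y) → maximal y<n hhy≢y))

-- Layered permutations

Reverses : (ℕ → ℕ) → ℕ → ℕ → Set
Reverses h p x = ∀ {i} → p ≤ i → i ≤ x → h i + i ≡ p + x

data Layered (h : ℕ → ℕ) : ℕ → ℕ → Set where
  []    : ∀ {p} → Layered h p p
  block : ∀ {p x r} → p ≤ x → Reverses h p x → Layered h (suc x) r → Layered h p r

Layered-≤ : ∀ {h p r} → Layered h p r → p ≤ r
Layered-≤ [] = ≤-refl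
Layered-≤ (block p≤x _ rest) = ≤-trans p≤x (<⇒≤ (Layered-≤ rest))

module _ {h p x} (reverses : Reverses h p x) where

  reverses-range : ∀ {i} → p ≤ i → i ≤ x → p ≤ h i × h i ≤ x
  reverses-range {i} p≤i i≤x =
    ≮⇒≥ (λ hi<p → <-irrefl (reverses p≤i i≤x) (+-mono-<-≤ hi<p i≤x)) ,
    ≮⇒≥ (λ x<hi → <-irrefl (sym (reverses p≤i i≤x))
                           (subst (p + x <_) (+-comm i (h i)) (+-mono-≤-< p≤i x<hi)))

  reverses-involutive : ∀ {i} → p ≤ i → i ≤ x → h (h i) ≡ i
  reverses-involutive {i} p≤i i≤x = +-cancelˡ-≡ (h i) _ _ (begin
    h i + h (h i) ≡⟨ +-comm (h i) (h (h i)) ⟩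
    h (h i) + h i ≡⟨ reverses (proj₁ (reverses-range p≤i i≤x)) (proj₂ (reverses-range p≤i i≤x)) ⟩
    p + x         ≡⟨ reverses p≤i i≤x ⟨
    h i + i       ∎)
    where open ≡-Reasoning

Layered⇒Involution : ∀ {h p r} → Layered h p r → Involution h p r
Layered⇒Involution [] p≤i i<p = ⊥-elim (<⇒≱ i<p p≤i)
Layered⇒Involution (block {x = x} p≤x reverses rest) {i} p≤i i<r with i ≤? x
... | yes i≤x = let p≤hi , hi≤x = reverses-range reverses p≤i i≤x
                in (p≤hi , <-≤-trans (s≤s hi≤x) (Layered-≤ rest)) , reverses-involutive reverses p≤i i≤x
... | no i≰x = let (x<hi , hi<r) , hhi≡i = Layered⇒Involution rest (≰⇒> i≰x) i<r
               in (≤-trans p≤x (<⇒≤ x<hi) , hi<r) , hhi≡i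

-- An occurrence starting in the first block lies inside it (later blocks take larger values),
-- but there h j + j = h l + l rules out h j < h l.
Layered⇒Avoids312 : ∀ {h p r} → Layered h p r → Avoids312 h p r
Layered⇒Avoids312 [] p≤i i<j j<l l<p _ _ = <⇒≱ (<-trans i<j (<-trans j<l l<p)) p≤i
Layered⇒Avoids312 (block {x = x} p≤x reverses rest) {i} {j} {l} p≤i i<j j<l l<r hj<hl hl<hi with i ≤? x
... | no i≰x = Layered⇒Avoids312 rest (≰⇒> i≰x) i<j j<l l<r hj<hl hl<hi
... | yes i≤x with l ≤? x
...   | no l≰x = <-asym hl<hi (≤-<-trans (proj₂ (reverses-range reverses p≤i i≤x))
                                          (proj₁ (proj₁ (Layered⇒Involution rest (≰⇒> l≰x) l<r))))
...   | yes l≤x = <-irrefl (trans (reverses (≤-trans p≤i (<⇒≤ i<j)) (<⇒≤ (<-≤-trans j<l l≤x)))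
                                  (sym (reverses (≤-trans p≤i (<⇒≤ (<-trans i<j j<l))) l≤x)))
                           (+-mono-< hj<hl j<l)

-- Strict decrease gives f (a + t) ≤ b - t counting from the left end and f (b - s) ≥ a + s
-- counting from the right end.
antitone-reverses : ∀ {f a b} → (∀ {i} → a ≤ i → i ≤ b → a ≤ f i × f i ≤ b) →
  (∀ {i j} → a ≤ i → i < j → j ≤ b → f j < f i) → Reverses f a b
antitone-reverses {f} {a} into decreasing {i} a≤i i≤b with m≤n⇒∃[o]m+o≡n a≤i | m≤n⇒∃[o]m+o≡n i≤b
... | t , refl | s , refl =
  trans (cong (_+ (a + t)) (≤-antisym fi≤a+s (lower s a≤i refl))) (rearrange a s t)
  where
  b = a + t + s
  rearrange : ∀ a s t → (a + s) + (a + t) ≡ a + (a + t + s)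
  rearrange = solve-∀
  swap : ∀ a t s → a + t + s ≡ a + s + t
  swap = solve-∀
  upper : ∀ t → a + t ≤ b → f (a + t) + t ≤ b
  upper zero a≤b = subst (_≤ b) (sym (+-identityʳ _)) (proj₂ (into (m≤m+n a 0) a≤b))
  upper (suc t) a+1+t≤b = begin
    f (a + suc t) + suc t   ≡⟨ +-suc _ t ⟩
    suc (f (a + suc t) + t) ≤⟨ +-monoˡ-≤ t (decreasing (m≤m+n a t) (+-monoʳ-< a ≤-refl) a+1+t≤b) ⟩
    f (a + t) + t           ≤⟨ upper t (≤-trans (+-monoʳ-≤ a (n≤1+n t)) a+1+t≤b) ⟩
    b                       ∎
    where open ≤-Reasoning
  lower : ∀ s {i} → a ≤ i → i + s ≡ b → a + s ≤ f i
  lower zero {i} a≤i i+0≡b =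
    subst (_≤ f i) (sym (+-identityʳ a)) (proj₁ (into a≤i (≤-reflexive (trans (sym (+-identityʳ i)) i+0≡b))))
  lower (suc s) {i} a≤i i+1+s≡b =
    subst (_≤ f i) (sym (+-suc a s))
      (≤-trans (s≤s (lower s (m≤n⇒m≤1+n a≤i) 1+i+s≡b))
               (decreasing a≤i (n<1+n i) (≤-trans (m≤m+n (suc i) s) (≤-reflexive 1+i+s≡b))))
    where 1+i+s≡b = trans (sym (+-suc i s)) i+1+s≡b
  fi≤a+s : f (a + t) ≤ a + s
  fi≤a+s = +-cancelʳ-≤ t _ _ (subst (f (a + t) + t ≤_) (swap a t s) (upper t (m≤m+n (a + t) s)))

module _ {h n} (involution : Involution h 0 n) (avoid : Avoids312 h 0 n) where

  private
    ClosedBelow : ℕ → Set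
    ClosedBelow p = ∀ {i} → i < p → h i < p

    image<n : ∀ {i} → i < n → h i < n
    image<n i<n = proj₂ (proj₁ (involution z≤n i<n))

    hh : ∀ {i} → i < n → h (h i) ≡ i
    hh i<n = proj₂ (involution z≤n i<n)

    injective : ∀ {a b} → a < n → b < n → h a ≡ h b → a ≡ b
    injective a<n b<n = involution-injective involution z≤n a<n z≤n b<n

    module _ {p} (p<n : p < n) (closed : ClosedBelow p) where

      x = h p
      x<n = image<n p<n

      block-start≤end : p ≤ x
      block-start≤end = ≮⇒≥ λ x<p → <-irrefl (hh p<n) (closed x<p)

      block-into : ∀ {i} → p ≤ i → i ≤ x → p ≤ h i × h i ≤ x
      block-into {i} p≤i i≤x = ≮⇒≥ hi≮p , ≮⇒≥ x≮hi
        where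
        i<n = ≤-<-trans i≤x x<n
        hi≮p : ¬ h i < p
        hi≮p hi<p = <⇒≱ (subst (_< p) (hh i<n) (closed hi<p)) p≤i
        x≮hi : ¬ x < h i
        x≮hi x<hi = avoid z≤n (<-trans p<i i<x) x<hi (image<n i<n)
                          (subst₂ _<_ (sym (hh p<n)) (sym (hh i<n)) p<i) (subst (_< x) (sym (hh i<n)) i<x)
          where
          p<i : p < i
          p<i = ≤∧≢⇒< p≤i λ { refl → <-irrefl refl x<hi }
          i<x : i < x
          i<x = ≤∧≢⇒< i≤x λ { refl → <⇒≱ x<hi (subst (_≤ x) (sym (hh p<n)) block-start≤end) }

      block-decreasing : ∀ {i j} → p ≤ i → i < j → j ≤ x → h j < h i
      block-decreasing {i} {j} p≤i i<j j≤x = ≰⇒> λ hi≤hj → avoid z≤n (p<i hi≤hj) i<j j<n (hi<hj hi≤hj) hj<x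
        where
        j<n = ≤-<-trans j≤x x<n
        i<n = <-trans i<j j<n
        hj<x : h j < x
        hj<x = ≤∧≢⇒< (proj₂ (block-into (≤-trans p≤i (<⇒≤ i<j)) j≤x))
                     (λ hj≡hp → <⇒≢ (≤-<-trans p≤i i<j) (sym (injective j<n p<n hj≡hp)))
        hi<hj : h i ≤ h j → h i < h j
        hi<hj hi≤hj = ≤∧≢⇒< hi≤hj (λ hi≡hj → <⇒≢ i<j (injective i<n j<n hi≡hj))
        p<i : h i ≤ h j → p < i
        p<i hi≤hj = ≤∧≢⇒< p≤i λ { refl → <-asym (hi<hj hi≤hj) hj<x }

      block-closed : ClosedBelow (suc x)
      block-closed {i} i<1+x with i <? p
      ... | yes i<p = <-≤-trans (closed i<p) (m≤n⇒m≤1+n block-start≤end)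
      ... | no i≮p = s≤s (proj₂ (block-into (≮⇒≥ i≮p) (s≤s⁻¹ i<1+x)))

    layered-from : ∀ p → Acc _<_ (n ∸ p) → p ≤ n → ClosedBelow p → Layered h p n
    layered-from p (acc more) p≤n closed with m≤n⇒m<n∨m≡n p≤n
    ... | inj₂ refl = []
    ... | inj₁ p<n =
      block (block-start≤end p<n closed) (antitone-reverses (block-into p<n closed) (block-decreasing p<n closed))
            (layered-from (suc (h p)) (more (∸-monoʳ-< (s≤s (block-start≤end p<n closed)) (image<n p<n)))
                          (image<n p<n) (block-closed p<n closed))

  avoiding-involution⇒Layered : Layered h 0 n
  avoiding-involution⇒Layered = layered-from 0 (<-wellFounded n) z≤n (λ ())

-- layered s (x ∷ w) holds when s ≤ x and w = (x - 1) … (s + 1) s w′ with w′ layered from x + 1.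
mutual
  layered : ℕ → List ℕ → Bool
  layered s [] = true
  layered s (x ∷ w) = (s ≤ᵇ x) ∧ descent s (suc x) (x ∸ s) w

  descent : ℕ → ℕ → ℕ → List ℕ → Bool
  descent s e zero w = layered e w
  descent s e (suc j) [] = false
  descent s e (suc j) (y ∷ w) = (y ≡ᵇ s + j) ∧ descent s e j w

module _ (h : ℕ → ℕ) where

  mutual
    layered-sound : ∀ p k → T (layered p (map h (segment p k))) → Layered h p (p + k)
    layered-sound p zero _ = subst (Layered h p) (sym (+-identityʳ p)) []
    layered-sound p (suc k) t with to T-∧ t
    ... | p≤ᵇhp , d with ≤ᵇ⇒≤ p (h p) p≤ᵇhp
    ... | p≤hp with descent-sound (h p ∸ p) (suc p) k (sym (trans (+-suc (h p ∸ p) p) (cong suc (m∸n+n≡m p≤hp)))) d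
    ... | run , rest = subst (Layered h p) (sym (+-suc p k)) (block p≤hp reverses rest)
      where
      reverses : Reverses h p (h p)
      reverses {i} p≤i i≤hp with m≤n⇒m<n∨m≡n p≤i
      ... | inj₁ p<i = run p<i i≤hp
      ... | inj₂ refl = +-comm (h i) i

    descent-sound : ∀ {s x} j q m → suc x ≡ j + q → T (descent s (suc x) j (map h (segment q m))) →
      (∀ {i} → q ≤ i → i ≤ x → h i + i ≡ s + x) × Layered h (suc x) (q + m)
    descent-sound zero _ m refl t = (λ 1+x≤i i≤x → ⊥-elim (<⇒≱ 1+x≤i i≤x)) , layered-sound _ m t
    descent-sound {s} {x} (suc j) q (suc m) refl t with to T-∧ t
    ... | hq≡ᵇs+j , d with descent-sound j (suc q) m (sym (+-suc j q)) d
    ... | run , rest = run′ , subst (Layered h (suc x)) (sym (+-suc q m)) rest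
      where
      run′ : ∀ {i} → q ≤ i → i ≤ x → h i + i ≡ s + x
      run′ {i} q≤i i≤x with m≤n⇒m<n∨m≡n q≤i
      ... | inj₁ q<i = run q<i i≤x
      ... | inj₂ refl = trans (cong (_+ q) (≡ᵇ⇒≡ (h q) (s + j) hq≡ᵇs+j)) (+-assoc s j q)

  mutual
    layered-complete : ∀ {p r} → Layered h p r → ∀ k → p + k ≡ r → T (layered p (map h (segment p k)))
    layered-complete [] zero _ = _
    layered-complete {p} [] (suc k) p+1+k≡p = ⊥-elim (m+1+n≢m p p+1+k≡p)
    layered-complete {p} (block p≤x _ rest) zero p+0≡r =
      ⊥-elim (<⇒≱ (≤-trans (s≤s p≤x) (Layered-≤ rest)) (≤-reflexive (trans (sym p+0≡r) (+-identityʳ p))))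
    layered-complete {p} (block {x = x} p≤x reverses rest) (suc k) p+1+k≡r =
      subst (λ y → T ((p ≤ᵇ y) ∧ descent p (suc y) (y ∸ p) (map h (segment (suc p) k)))) (sym hp≡x)
        (from T-∧ (≤⇒≤ᵇ p≤x , descent-complete (x ∸ p) (suc p) k x+1≡[x∸p]+[p+1] (reverses ∘ <⇒≤) rest
                                                (trans (sym (+-suc p k)) p+1+k≡r)))
      where
      hp≡x : h p ≡ x
      hp≡x = +-cancelʳ-≡ p (h p) x (trans (reverses ≤-refl p≤x) (+-comm p x))
      x+1≡[x∸p]+[p+1] : suc x ≡ x ∸ p + suc p
      x+1≡[x∸p]+[p+1] = sym (trans (+-suc (x ∸ p) p) (cong suc (m∸n+n≡m p≤x)))

    descent-complete : ∀ {s x r} j q m → suc x ≡ j + q → (∀ {i} → q ≤ i → i ≤ x → h i + i ≡ s + x) →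
      Layered h (suc x) r → q + m ≡ r → T (descent s (suc x) j (map h (segment q m)))
    descent-complete zero _ m refl _ rest q+m≡r = layered-complete rest m q+m≡r
    descent-complete (suc j) q zero refl _ rest q+0≡r =
      ⊥-elim (<⇒≱ (≤-trans (s≤s (m≤n+m q j)) (Layered-≤ rest)) (≤-reflexive (trans (sym q+0≡r) (+-identityʳ q))))
    descent-complete {s} (suc j) q (suc m) refl run rest q+1+m≡r =
      from T-∧ (≡⇒≡ᵇ (h q) (s + j) hq≡s+j ,
                descent-complete j (suc q) m (sym (+-suc j q)) (run ∘ <⇒≤) rest (trans (sym (+-suc q m)) q+1+m≡r))
      where
      hq≡s+j : h q ≡ s + j
      hq≡s+j = +-cancelʳ-≡ q (h q) (s + j) (trans (run ≤-refl (m≤n+m q j)) (sym (+-assoc s j q)))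

module _ {h n} (maps : MapsBelow h n) where

  θ-avoiding⇔layered :
    (InjectiveBelow h n × Avoids312 h 0 n × ¬ Has312 (θℕ h n)) ⇔ T (layered 0 (map h (segment 0 n)))
  θ-avoiding⇔layered = mk⇔ layered-from-avoidance avoidance-from-layered
    where
    layered-from-avoidance :
      InjectiveBelow h n × Avoids312 h 0 n × ¬ Has312 (θℕ h n) → T (layered 0 (map h (segment 0 n)))
    layered-from-avoidance (injective , avoid , avoidθ) =
      layered-complete h (avoiding-involution⇒Layered involution avoid) n refl
      where
      involution : Involution h 0 n
      involution _ i<n = (z≤n , maps i<n) , θ-avoiding⇒involutive maps injective avoid avoidθ i<n
    avoidance-from-layered :
      T (layered 0 (map h (segment 0 n))) → InjectiveBelow h n × Avoids312 h 0 n × ¬ Has312 (θℕ h n)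
    avoidance-from-layered t =
      (λ i<n j<n → involution-injective involution z≤n i<n z≤n j<n) , avoid , θℕ-avoids312 involution avoid
      where
      layers = layered-sound h 0 n t
      involution = Layered⇒Involution layers
      avoid = Layered⇒Avoids312 layers

-- Counting layered words

length-filterᵇ-++ : ∀ {A : Set} (p : A → Bool) xs ys →
  length (filterᵇ p (xs ++ ys)) ≡ length (filterᵇ p xs) + length (filterᵇ p ys)
length-filterᵇ-++ p xs ys = trans (cong length (filter-++ (T? ∘ p) xs ys)) (length-++ (filterᵇ p xs))

length-filterᵇ-concatMap : ∀ {A B : Set} (p : B → Bool) (f : A → List B) xs →
  length (filterᵇ p (concatMap f xs)) ≡ sum (map (λ x → length (filterᵇ p (f x))) xs)
length-filterᵇ-concatMap p f [] = refl
length-filterᵇ-concatMap p f (x ∷ xs) =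
  trans (length-filterᵇ-++ p (f x) (concatMap f xs)) (cong (_ +_) (length-filterᵇ-concatMap p f xs))

length-filterᵇ-map : ∀ {A B : Set} (p : B → Bool) (g : A → B) xs →
  length (filterᵇ p (map g xs)) ≡ length (filterᵇ (p ∘ g) xs)
length-filterᵇ-map p g [] = refl
length-filterᵇ-map p g (x ∷ xs) with p (g x)
... | true = cong suc (length-filterᵇ-map p g xs)
... | false = length-filterᵇ-map p g xs

length-filterᵇ-false : ∀ {A : Set} (xs : List A) → length (filterᵇ (λ _ → false) xs) ≡ 0
length-filterᵇ-false [] = refl
length-filterᵇ-false (x ∷ xs) = length-filterᵇ-false xs

length-filterᵇ-filter : ∀ {A : Set} {U : A → Set} (U? : Decidable U) (p q : A → Bool) →
  (∀ x → (U x × T (p x)) ⇔ T (q x)) → ∀ xs → length (filterᵇ p (filter U? xs)) ≡ length (filterᵇ q xs)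
length-filterᵇ-filter U? p q equiv [] = refl
length-filterᵇ-filter U? p q equiv (x ∷ xs) with U? x
... | yes u with p x | q x | equiv x
...   | true  | true  | _ = cong suc (length-filterᵇ-filter U? p q equiv xs)
...   | true  | false | e = ⊥-elim (to e (u , _))
...   | false | true  | e = ⊥-elim (proj₂ (from e _))
...   | false | false | _ = length-filterᵇ-filter U? p q equiv xs
length-filterᵇ-filter U? p q equiv (x ∷ xs) | no ¬u with q x | equiv x
...   | true  | e = ⊥-elim (¬u (proj₁ (from e _)))
...   | false | _ = length-filterᵇ-filter U? p q equiv xs

segment-++ : ∀ s a b → segment s (a + b) ≡ segment s a ++ segment (s + a) b
segment-++ s zero b = cong (λ t → segment t b) (sym (+-identityʳ s))
segment-++ s (suc a) b =
  cong (s ∷_) (trans (segment-++ (suc s) a b) (cong (λ t → segment (suc s) a ++ segment t b) (sym (+-suc s a))))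

segment-shift : ∀ s t m → segment (s + t) m ≡ map (s +_) (segment t m)
segment-shift s t zero = refl
segment-shift s t (suc m) =
  cong (s + t ∷_) (trans (cong (λ u → segment u m) (sym (+-suc s t))) (segment-shift s (suc t) m))

tabulate-segment : ∀ s {m} (f : Fin m → ℕ) → (∀ i → f i ≡ s + toℕ i) → tabulate f ≡ segment s m
tabulate-segment s {zero} f f≗ = refl
tabulate-segment s {suc m} f f≗ =
  cong₂ _∷_ (trans (f≗ Fin.zero) (+-identityʳ s))
            (tabulate-segment (suc s) (f ∘ Fin.suc) (λ i → trans (f≗ (Fin.suc i)) (+-suc s (toℕ i))))

allFin-segment : ∀ n → map toℕ (allFin n) ≡ segment 0 n
allFin-segment n = trans (map-tabulate (λ i → i) toℕ) (tabulate-segment 0 toℕ (λ _ → refl))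

∑ : ℕ → ℕ → (ℕ → ℕ) → ℕ
∑ s m φ = sum (map φ (segment s m))

∑-cong : ∀ {s m φ ψ} → (∀ {i} → InSegment s m i → φ i ≡ ψ i) → ∑ s m φ ≡ ∑ s m ψ
∑-cong {s} {zero} φ≗ψ = refl
∑-cong {s} {suc m} φ≗ψ = cong₂ _+_ (φ≗ψ (start∈segment s m)) (∑-cong (φ≗ψ ∘ InSegment-suc⁻))

∑-zero : ∀ {s m φ} → (∀ {i} → InSegment s m i → φ i ≡ 0) → ∑ s m φ ≡ 0
∑-zero {s} {m} φ≗0 = trans (∑-cong φ≗0) (∑-const0 s m)
  where
  ∑-const0 : ∀ s m → ∑ s m (λ _ → 0) ≡ 0
  ∑-const0 s zero = refl
  ∑-const0 s (suc m) = ∑-const0 (suc s) m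

∑-split : ∀ s a b φ → ∑ s (a + b) φ ≡ ∑ s a φ + ∑ (s + a) b φ
∑-split s a b φ = trans (cong (sum ∘ map φ) (segment-++ s a b))
                        (trans (cong sum (map-++ φ (segment s a) _)) (sum-++ (map φ (segment s a)) _))

∑-shift : ∀ s m φ → ∑ s m φ ≡ ∑ 0 m (λ t → φ (s + t))
∑-shift s m φ = trans (cong (sum ∘ map φ) (trans (cong (λ u → segment u m) (sym (+-identityʳ s))) (segment-shift s 0 m)))
                      (cong sum (sym (map-∘ (segment 0 m))))

∑-support : ∀ {n s m φ} → s + m ≤ n → (∀ {i} → i < n → ¬ InSegment s m i → φ i ≡ 0) → ∑ 0 n φ ≡ ∑ s m φ
∑-support {s = s} {m} {φ} s+m≤n outside with m≤n⇒∃[o]m+o≡n s+m≤n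
... | r , refl = begin
  ∑ 0 (s + m + r) φ                  ≡⟨ ∑-split 0 (s + m) r φ ⟩
  ∑ 0 (s + m) φ + ∑ (s + m) r φ      ≡⟨ cong₂ _+_ (∑-split 0 s m φ) (∑-zero after) ⟩
  ∑ 0 s φ + ∑ s m φ + 0              ≡⟨ cong (λ z → z + ∑ s m φ + 0) (∑-zero before) ⟩
  ∑ s m φ + 0                        ≡⟨ +-identityʳ _ ⟩
  ∑ s m φ                            ∎
  where
  open ≡-Reasoning
  before : ∀ {i} → InSegment 0 s i → φ i ≡ 0
  before (_ , i<s) = outside (<-≤-trans i<s (≤-trans (m≤m+n s m) (m≤m+n (s + m) r))) (λ (s≤i , _) → <⇒≱ i<s s≤i)
  after : ∀ {i} → InSegment (s + m) r i → φ i ≡ 0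
  after (s+m≤i , i<) = outside i< (λ (_ , i<s+m) → <⇒≱ i<s+m s+m≤i)

∑-single : ∀ {n t φ} → t < n → (∀ {i} → i < n → i ≢ t → φ i ≡ 0) → ∑ 0 n φ ≡ φ t
∑-single {n} {t} {φ} t<n vanish =
  trans (∑-support (subst (_≤ n) (+-comm 1 t) t<n) (λ i<n i∉ → vanish i<n λ { refl → i∉ (≤-refl , m<m+n t z<s) }))
        (+-identityʳ (φ t))

#compositions : ℕ → ℕ
#compositions zero = 1
#compositions (suc k) = 2 ^ k

∑-#compositions : ∀ k → ∑ 0 (suc k) (λ t → #compositions (k ∸ t)) ≡ 2 ^ k
∑-#compositions zero = refl
∑-#compositions (suc k) =
  cong (2 ^ k +_) (trans (∑-shift 1 (suc k) _) (trans (∑-#compositions k) (sym (+-identityʳ (2 ^ k)))))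

module Counting (n : ℕ) where

  count : (List ℕ → Bool) → ℕ → ℕ
  count P k = length (filterᵇ (P ∘ map toℕ ∘ toList) (words {n} k))

  count-∷ : ∀ P k → count P (suc k) ≡ ∑ 0 n (λ x → count (P ∘ (x ∷_)) k)
  count-∷ P k = begin
    count P (suc k)
      ≡⟨ length-filterᵇ-concatMap _ (λ x → map (x ∷ᵥ_) (words k)) (allFin n) ⟩
    sum (map (λ x → length (filterᵇ (P ∘ map toℕ ∘ toList) (map (x ∷ᵥ_) (words k)))) (allFin n))
      ≡⟨ cong sum (map-cong (λ x → length-filterᵇ-map _ (x ∷ᵥ_) (words k)) (allFin n)) ⟩
    sum (map (λ x → count (P ∘ (toℕ x ∷_)) k) (allFin n))
      ≡⟨ cong sum (map-∘ (allFin n)) ⟩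
    sum (map (λ y → count (P ∘ (y ∷_)) k) (map toℕ (allFin n)))
      ≡⟨ cong (sum ∘ map _) (allFin-segment n) ⟩
    ∑ 0 n (λ y → count (P ∘ (y ∷_)) k) ∎
    where open ≡-Reasoning

  count-∧-T : ∀ {b} (P : List ℕ → Bool) k → T b → count (λ w → b ∧ P w) k ≡ count P k
  count-∧-T {true} P k _ = refl

  count-∧-¬T : ∀ {b} (P : List ℕ → Bool) k → ¬ T b → count (λ w → b ∧ P w) k ≡ 0
  count-∧-¬T {false} P k _ = length-filterᵇ-false (words k)
  count-∧-¬T {true} P k ¬t = ⊥-elim (¬t _)

  count-descent-step : ∀ {s e} j k → s + suc j ≤ n →
    count (descent s e (suc j)) (suc k) ≡ count (descent s e j) k
  count-descent-step {s} {e} j k s+1+j≤n =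
    trans (count-∷ (descent s e (suc j)) k)
          (trans (∑-single s+j<n (λ {i} _ i≢s+j → count-∧-¬T (descent s e j) k (i≢s+j ∘ ≡ᵇ⇒≡ i (s + j))))
                 (count-∧-T (descent s e j) k (≡⇒≡ᵇ (s + j) (s + j) refl)))
    where s+j<n = subst (_≤ n) (+-suc s j) s+1+j≤n

  count-descent : ∀ {s e} j k → s + j ≤ n → j ≤ k → count (descent s e j) k ≡ count (layered e) (k ∸ j)
  count-descent zero k _ _ = refl
  count-descent {s} (suc j) (suc k) s+1+j≤n (s≤s j≤k) =
    trans (count-descent-step j k s+1+j≤n) (count-descent j k (≤-trans (+-monoʳ-≤ s (n≤1+n j)) s+1+j≤n) j≤k)

  count-descent-overlong : ∀ {s e} j k → s + j ≤ n → k < j → count (descent s e j) k ≡ 0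
  count-descent-overlong (suc j) zero _ _ = refl
  count-descent-overlong {s} (suc j) (suc k) s+1+j≤n (s≤s k<j) =
    trans (count-descent-step j k s+1+j≤n)
          (count-descent-overlong j k (≤-trans (+-monoʳ-≤ s (n≤1+n j)) s+1+j≤n) k<j)

  count-layered-suc : ∀ {s} k → s + suc k ≤ n →
    count (layered s) (suc k) ≡ ∑ 0 (suc k) (λ t → count (layered (suc (s + t))) (k ∸ t))
  count-layered-suc {s} k s+1+k≤n = begin
    count (layered s) (suc k)        ≡⟨ count-∷ (layered s) k ⟩
    ∑ 0 n φ                          ≡⟨ ∑-support s+1+k≤n outside ⟩
    ∑ s (suc k) φ                    ≡⟨ ∑-shift s (suc k) φ ⟩
    ∑ 0 (suc k) (λ t → φ (s + t))    ≡⟨ ∑-cong inside ⟩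
    ∑ 0 (suc k) (λ t → count (layered (suc (s + t))) (k ∸ t)) ∎
    where
    open ≡-Reasoning
    φ : ℕ → ℕ
    φ x = count (λ w → (s ≤ᵇ x) ∧ descent s (suc x) (x ∸ s) w) k
    outside : ∀ {x} → x < n → ¬ InSegment s (suc k) x → φ x ≡ 0
    outside {x} x<n x∉ with s ≤? x
    ... | no s≰x = count-∧-¬T (descent s (suc x) (x ∸ s)) k (s≰x ∘ ≤ᵇ⇒≤ s x)
    ... | yes s≤x = trans (count-∧-T (descent s (suc x) (x ∸ s)) k (≤⇒≤ᵇ s≤x))
                          (count-descent-overlong {s} {suc x} (x ∸ s) k s+[x∸s]≤n k<x∸s)
      where
      s+[x∸s]≤n = ≤-trans (≤-reflexive (m+[n∸m]≡n s≤x)) (<⇒≤ x<n)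
      k<x∸s : k < x ∸ s
      k<x∸s = m+n≤o⇒m≤o∸n (suc k) (subst (_≤ x) (+-comm s (suc k)) (≮⇒≥ (λ x< → x∉ (s≤x , x<))))
    inside : ∀ {t} → InSegment 0 (suc k) t → φ (s + t) ≡ count (layered (suc (s + t))) (k ∸ t)
    inside {t} (_ , t<1+k) = begin
      φ (s + t)                                  ≡⟨ count-∧-T (descent s e (s + t ∸ s)) k (≤⇒≤ᵇ (m≤m+n s t)) ⟩
      count (descent s e (s + t ∸ s)) k          ≡⟨ cong (λ j → count (descent s e j) k) (m+n∸m≡n s t) ⟩
      count (descent s e t) k                    ≡⟨ count-descent t k s+t≤n (s≤s⁻¹ t<1+k) ⟩
      count (layered e) (k ∸ t)                  ∎
      where
      e = suc (s + t)
      s+t≤n = ≤-trans (+-monoʳ-≤ s (s≤s⁻¹ (m≤n⇒m≤1+n t<1+k))) s+1+k≤n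

  count-layered : ∀ k s → s + k ≤ n → count (layered s) k ≡ #compositions k
  count-layered k = counted k (<-wellFounded k)
    where
    counted : ∀ k → Acc _<_ k → ∀ s → s + k ≤ n → count (layered s) k ≡ #compositions k
    counted zero _ s _ = refl
    counted (suc k) (acc smaller) s s+1+k≤n = begin
      count (layered s) (suc k)                                   ≡⟨ count-layered-suc k s+1+k≤n ⟩
      ∑ 0 (suc k) (λ t → count (layered (suc (s + t))) (k ∸ t))   ≡⟨ ∑-cong by-induction ⟩
      ∑ 0 (suc k) (λ t → #compositions (k ∸ t))                   ≡⟨ ∑-#compositions k ⟩
      2 ^ k                                                       ∎
      where
      open ≡-Reasoning
      by-induction : ∀ {t} → InSegment 0 (suc k) t → count (layered (suc (s + t))) (k ∸ t) ≡ #compositions (k ∸ t)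
      by-induction {t} (_ , t<1+k) = counted (k ∸ t) (smaller (s≤s (m∸n≤m k t))) (suc (s + t)) (≤-trans fits s+1+k≤n)
        where
        fits : suc (s + t) + (k ∸ t) ≤ s + suc k
        fits = ≤-reflexive (trans (cong suc (trans (+-assoc s t (k ∸ t)) (cong (s +_) (m+[n∸m]≡n (s≤s⁻¹ t<1+k)))))
                                  (sym (+-suc s k)))

toList-tabulate : ∀ {A : Set} {k} (v : Vec A k) → toList v ≡ tabulate (lookup v)
toList-tabulate []ᵥ = refl
toList-tabulate (x ∷ᵥ v) = cong (x ∷_) (toList-tabulate v)

tabulate-unique⁻ : ∀ {A : Set} {k} (f : Fin k → A) → Unique (tabulate f) → ∀ {i j} → f i ≡ f j → i ≡ j
tabulate-unique⁻ f (_ ∷ _) {Fin.zero} {Fin.zero} _ = refl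
tabulate-unique⁻ f (f0∉ ∷ _) {Fin.zero} {Fin.suc j} f0≡fj = ⊥-elim (tabulate⁻ f0∉ j f0≡fj)
tabulate-unique⁻ f (f0∉ ∷ _) {Fin.suc i} {Fin.zero} fi≡f0 = ⊥-elim (tabulate⁻ f0∉ i (sym fi≡f0))
tabulate-unique⁻ f (_ ∷ unique) {Fin.suc i} {Fin.suc j} fi≡fj =
  cong Fin.suc (tabulate-unique⁻ (f ∘ Fin.suc) unique fi≡fj)

module _ {n} .{{_ : NonZero n}} (π : Vec (Fin n) n) where

  private
    -- reducing mod n only makes h total; positions beyond n are never consulted
    h : ℕ → ℕ
    h i = toℕ (lookup π (i mod n))

    toℕ-mod : ∀ {i} → i < n → toℕ (i mod n) ≡ i
    toℕ-mod i<n = trans (toℕ-fromℕ< _) (m<n⇒m%n≡m i<n)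

    h-toℕ : ∀ x → h (toℕ x) ≡ toℕ (lookup π x)
    h-toℕ x = cong (toℕ ∘ lookup π) (toℕ-injective (toℕ-mod (toℕ<n x)))

    maps : MapsBelow h n
    maps {i} _ = toℕ<n (lookup π (i mod n))

    word : map toℕ (toList π) ≡ map h (segment 0 n)
    word = begin
      map toℕ (toList π)               ≡⟨ cong (map toℕ) (toList-tabulate π) ⟩
      map toℕ (tabulate (lookup π))    ≡⟨ map-tabulate (lookup π) toℕ ⟩
      tabulate (toℕ ∘ lookup π)        ≡⟨ tabulate-cong (sym ∘ h-toℕ) ⟩
      tabulate (h ∘ toℕ)               ≡⟨ map-tabulate toℕ h ⟨
      map h (tabulate toℕ)             ≡⟨ cong (map h) (tabulate-segment 0 toℕ (λ _ → refl)) ⟩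
      map h (segment 0 n)              ∎
      where open ≡-Reasoning

    walk-iterate : ∀ m k a →
      map toℕ (takeWhile (λ x → ¬? (x ≟ᶠ m)) (iterate (lookup π) a k)) ≡ walk h (toℕ m) (toℕ a) k
    walk-iterate m zero a = refl
    walk-iterate m (suc k) a with a ≟ᶠ m | toℕ a ≡ᵇ toℕ m in eq
    ... | yes refl | true = refl
    ... | yes refl | false = ⊥-elim (≡ᵇ-false⇒≢ {toℕ a} eq refl)
    ... | no a≢m | true = ⊥-elim (a≢m (toℕ-injective (≡ᵇ-true⇒≡ eq)))
    ... | no _ | false =
      cong (toℕ a ∷_) (trans (walk-iterate m k (lookup π a)) (cong (λ b → walk h (toℕ m) b k) (sym (h-toℕ a))))

    orbit-cycleFrom : ∀ m → map toℕ (orbit π m) ≡ cycleFrom h n (toℕ m)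
    orbit-cycleFrom m =
      cong (toℕ m ∷_) (trans (walk-iterate m n (lookup π m)) (cong (λ b → walk h (toℕ m) b n) (sym (h-toℕ m))))

    block-cycleBlock : ∀ m → map toℕ (if isCycleMax π m then orbit π m else []) ≡ cycleBlock h n (toℕ m)
    block-cycleBlock m = trans (if-float (map toℕ) (isCycleMax π m))
      (cong₂ (λ b l → if b then l else [])
             (trans (cong and (map-∘ (orbit π m))) (cong (all (_≤ᵇ toℕ m)) (orbit-cycleFrom m)))
             (orbit-cycleFrom m))

    θ-θℕ : map toℕ (θ π) ≡ θℕ h n
    θ-θℕ = begin
      map toℕ (θ π)                                   ≡⟨ map-concatMap toℕ _ (allFin n) ⟩
      concatMap (map toℕ ∘ _) (allFin n)              ≡⟨ concatMap-cong block-cycleBlock (allFin n) ⟩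
      concatMap (cycleBlock h n ∘ toℕ) (allFin n)     ≡⟨ concatMap-map (cycleBlock h n) toℕ (allFin n) ⟨
      concatMap (cycleBlock h n) (map toℕ (allFin n)) ≡⟨ cong (concatMap (cycleBlock h n)) (allFin-segment n) ⟩
      θℕ h n                                          ∎
      where open ≡-Reasoning

    unique⇔injective : Unique (toList π) ⇔ InjectiveBelow h n
    unique⇔injective = mk⇔ injective unique
      where
      injective : Unique (toList π) → InjectiveBelow h n
      injective u i<n j<n hi≡hj = trans (sym (toℕ-mod i<n)) (trans (cong toℕ
        (tabulate-unique⁻ (lookup π) (subst Unique (toList-tabulate π) u) (toℕ-injective hi≡hj))) (toℕ-mod j<n))
      unique : InjectiveBelow h n → Unique (toList π)
      unique inj = subst Unique (sym (toList-tabulate π)) (tabulate⁺ λ {x} {y} πx≡πy →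
        toℕ-injective (inj (toℕ<n x) (toℕ<n y) (trans (h-toℕ x) (trans (cong toℕ πx≡πy) (sym (h-toℕ y))))))

  counted⇔layered :
    (Unique (toList π) × T (avoids312 (toList π) ∧ avoids312 (θ π))) ⇔ T (layered 0 (map toℕ (toList π)))
  counted⇔layered = mk⇔ forward backward
    where
    forward : Unique (toList π) × T (avoids312 (toList π) ∧ avoids312 (θ π)) → T (layered 0 (map toℕ (toList π)))
    forward (unique , avoidance) =
      let avoidsπ , avoidsθ = to T-∧ avoidance
      in subst (T ∘ layered 0) (sym word) (to (θ-avoiding⇔layered maps)
           (to unique⇔injective unique ,
            to (¬Has312⇔Avoids312 h 0 n) (subst (¬_ ∘ Has312) word (to (avoids312⇔¬Has312 (toList π)) avoidsπ)) ,
            subst (¬_ ∘ Has312) θ-θℕ (to (avoids312⇔¬Has312 (θ π)) avoidsθ)))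
    backward : T (layered 0 (map toℕ (toList π))) → Unique (toList π) × T (avoids312 (toList π) ∧ avoids312 (θ π))
    backward t =
      let injective , avoid , avoidθ = from (θ-avoiding⇔layered maps) (subst (T ∘ layered 0) word t)
      in from unique⇔injective injective ,
         from T-∧ (from (avoids312⇔¬Has312 (toList π))
                        (subst (¬_ ∘ Has312) (sym word) (from (¬Has312⇔Avoids312 h 0 n) avoid)) ,
                   from (avoids312⇔¬Has312 (θ π)) (subst (¬_ ∘ Has312) (sym θ-θℕ) avoidθ))

theorem3p9 : (n : ℕ) → 1 ≤ n → count312θ n ≡ 2 ^ (n ∸ 1)
theorem3p9 (suc n) _ = begin
  count312θ (suc n)                  ≡⟨ length-filterᵇ-filter _ _ _ counted⇔layered (words (suc n)) ⟩
  count (suc n) (layered 0) (suc n)  ≡⟨ count-layered (suc n) (suc n) 0 ≤-refl ⟩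
  2 ^ n                              ∎
  where
  open ≡-Reasoning
  open Counting using (count; count-layered)
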